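{- Let $n$, $k$, $t$ and $s$ be positive integers with $k\geq t+3$ and $n\geq 3\binom{t+2}{2}\left((k-t+1)^{2}+s\right)$. For positive integers $x$ define $$g(n,k,t,s,x)= (x-t)\binom{n-t-1}{k-t-1}+(k-x+1)(k-t+1)\binom{n-t-2}{k-t-2}+t(k-t)\binom{n-x}{k-x}+s(k-x+3).$$ Then $g(n,k,t,s,x)<g(n,k,t,s,x+1)$ for every $x\in\{t+2,t+3,\ldots,k-1\}$. -}

module Defs where

open import Data.Nat using (ℕ; _+_; _*_; _∸_)
open import Data.Nat.Combinatorics using (_C_)

-- g(n,k,t,s,x) =
--   (x-t) C(n-t-1,k-t-1) + (k-x+1)(k-t+1) C(n-t-2,k-t-2)
--   + t(k-t) C(n-x,k-x) + s(k-x+3)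
-- Truncated subtraction ∸ is used; for the range of x in the lemma
-- (t+2 ≤ x ≤ k, k ≥ t+3, n large) every subtraction is exact.
g : ℕ → ℕ → ℕ → ℕ → ℕ → ℕ
g n k t s x =
  (x ∸ t) * ((n ∸ t ∸ 1) C (k ∸ t ∸ 1))
  + (k + 1 ∸ x) * (k + 1 ∸ t) * ((n ∸ t ∸ 2) C (k ∸ t ∸ 2))
  + t * (k ∸ t) * ((n ∸ x) C (k ∸ x))
  + s * (k + 3 ∸ x)

{-# OPTIONS --safe #-}
-- By Pascal's rule, g(x) + C(n-t-1,k-t-1) = g(x+1) + (k-t+1) B + t(k-t) C(n-x-1,k-x) + s
-- with B = C(n-t-2,k-t-2), so it suffices that the last three terms stay below C(n-t-1,k-t-1).
-- For x ≥ t+2 we have C(n-x-1,k-x) ≤ B, so these terms are at most aB + s with a = k-t+1+t(k-t).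
-- The absorption identity (k-t-1) C(n-t-1,k-t-1) = (n-t-1) B together with B ≥ k-t-1 gives
-- aB + s < C(n-t-1,k-t-1) as soon as (k-t-1) a + s ≤ n-t-2, which the lower bound on n provides.

module Submission where

open import Defs
open import Data.Nat
  using (ℕ; zero; suc; _+_; _*_; _∸_; _^_; _≤_; _<_; s≤s; z≤n; NonZero; _≤′_; ≤′-refl; ≤′-step)
open import Data.Nat.Properties
open import Data.Nat.Combinatorics using (_C_; nCk+nC[k+1]≡[n+1]C[k+1]; nCn≡1; nC1≡n; k>n⇒nCk≡0)
open import Data.Nat.Tactic.RingSolver using (solve-∀)
open import Relation.Binary.PropositionalEquality
  using (_≡_; refl; sym; trans; cong; cong₂; subst; subst₂; module ≡-Reasoning)

nCk≤[1+n]Ck : ∀ n k → n C k ≤ suc n C k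
nCk≤[1+n]Ck n zero    = ≤-refl
nCk≤[1+n]Ck n (suc k) = subst (n C suc k ≤_) (nCk+nC[k+1]≡[n+1]C[k+1] n k) (m≤n+m _ _)

nCk≤[1+n]C[1+k] : ∀ n k → n C k ≤ suc n C suc k
nCk≤[1+n]C[1+k] n k = subst (n C k ≤_) (nCk+nC[k+1]≡[n+1]C[k+1] n k) (m≤m+n _ _)

C-monoˡ-≤ : ∀ {m n} k → m ≤ n → m C k ≤ n C k
C-monoˡ-≤ k m≤n = go (≤⇒≤′ m≤n)
  where
  go : ∀ {m n} → m ≤′ n → m C k ≤ n C k
  go ≤′-refl            = ≤-refl
  go (≤′-step {n} m≤′n) = ≤-trans (go m≤′n) (nCk≤[1+n]Ck n k)

[n∸1+j]C[k∸1+j]≤[n∸j]C[k∸j] : ∀ n k j → k ≤ n →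
  (n ∸ suc j) C (k ∸ suc j) ≤ (n ∸ j) C (k ∸ j)
[n∸1+j]C[k∸1+j]≤[n∸j]C[k∸j] n       zero    j       _         rewrite 0∸n≡0 j = ≤-refl
[n∸1+j]C[k∸1+j]≤[n∸j]C[k∸j] (suc n) (suc k) zero    _         = nCk≤[1+n]C[1+k] n k
[n∸1+j]C[k∸1+j]≤[n∸j]C[k∸j] (suc n) (suc k) (suc j) (s≤s k≤n) =
  [n∸1+j]C[k∸1+j]≤[n∸j]C[k∸j] n k j k≤n

[n∸j]C[k∸j]-antitone : ∀ {n k i j} → k ≤ n → i ≤ j → (n ∸ j) C (k ∸ j) ≤ (n ∸ i) C (k ∸ i)
[n∸j]C[k∸j]-antitone {n} {k} k≤n i≤j = go (≤⇒≤′ i≤j)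
  where
  go : ∀ {i j} → i ≤′ j → (n ∸ j) C (k ∸ j) ≤ (n ∸ i) C (k ∸ i)
  go ≤′-refl            = ≤-refl
  go (≤′-step {j} i≤′j) = ≤-trans ([n∸1+j]C[k∸1+j]≤[n∸j]C[k∸j] n k j k≤n) (go i≤′j)

[n∸[x+1]]C[k∸x]≤[n∸i]C[k∸i] : ∀ {n k i x} → k ≤ n → i ≤ x →
  (n ∸ (x + 1)) C (k ∸ x) ≤ (n ∸ i) C (k ∸ i)
[n∸[x+1]]C[k∸x]≤[n∸i]C[k∸i] {n} {k} {i} {x} k≤n i≤x =
  ≤-trans (C-monoˡ-≤ (k ∸ x) (∸-monoʳ-≤ n (m≤m+n x 1))) ([n∸j]C[k∸j]-antitone k≤n i≤x)

[1+n]Cn≡1+n : ∀ n → suc n C n ≡ suc n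
[1+n]Cn≡1+n zero    = refl
[1+n]Cn≡1+n (suc n) = begin
  suc (suc n) C suc n           ≡⟨ nCk+nC[k+1]≡[n+1]C[k+1] (suc n) n ⟨
  suc n C n + suc n C suc n     ≡⟨ cong₂ _+_ ([1+n]Cn≡1+n n) (nCn≡1 (suc n)) ⟩
  suc n + 1                     ≡⟨ +-comm (suc n) 1 ⟩
  suc (suc n)                   ∎
  where open ≡-Reasoning

[1+k]*[1+n]C[1+k]≡[1+n]*nCk : ∀ n k → suc k * (suc n C suc k) ≡ suc n * (n C k)
[1+k]*[1+n]C[1+k]≡[1+n]*nCk n zero rewrite nC1≡n (suc n) = *-comm 1 (suc n)
[1+k]*[1+n]C[1+k]≡[1+n]*nCk zero (suc k)
  rewrite k>n⇒nCk≡0 {1} {suc (suc k)} (s≤s (s≤s z≤n)) | k>n⇒nCk≡0 {0} {suc k} (s≤s z≤n) = *-zeroʳ k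
[1+k]*[1+n]C[1+k]≡[1+n]*nCk (suc n) (suc k) = begin
  suc (suc k) * (suc (suc n) C suc (suc k))
    ≡⟨ cong (suc (suc k) *_) (nCk+nC[k+1]≡[n+1]C[k+1] (suc n) (suc k)) ⟨
  suc (suc k) * (suc n C suc k + suc n C suc (suc k))
    ≡⟨ distribute (suc n C suc k) (suc n C suc (suc k)) k ⟩
  suc n C suc k + (suc k * (suc n C suc k) + suc (suc k) * (suc n C suc (suc k)))
    ≡⟨ cong (suc n C suc k +_)
         (cong₂ _+_ ([1+k]*[1+n]C[1+k]≡[1+n]*nCk n k) ([1+k]*[1+n]C[1+k]≡[1+n]*nCk n (suc k))) ⟩
  suc n C suc k + (suc n * (n C k) + suc n * (n C suc k))
    ≡⟨ cong (suc n C suc k +_) (*-distribˡ-+ (suc n) (n C k) (n C suc k)) ⟨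
  suc n C suc k + suc n * (n C k + n C suc k)
    ≡⟨ cong (λ z → suc n C suc k + suc n * z) (nCk+nC[k+1]≡[n+1]C[k+1] n k) ⟩
  suc (suc n) * (suc n C suc k)
    ∎
  where
  open ≡-Reasoning
  distribute : ∀ a b k → suc (suc k) * (a + b) ≡ a + (suc k * a + suc (suc k) * b)
  distribute = solve-∀

a*nCk+s<[1+n]C[1+k] : ∀ {n k a s} .{{_ : NonZero a}} → suc k * a + s ≤ n → a * (n C k) + s < suc n C suc k
a*nCk+s<[1+n]C[1+k] {n} {k} {a} {s} bound = *-cancelˡ-< (suc k) _ _ (begin-strict
  suc k * (a * B + s)         ≡⟨ expand (suc k) a B s ⟩
  suc k * a * B + suc k * s   <⟨ +-monoʳ-< (suc k * a * B) s[1+k]<[1+s]B ⟩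
  suc k * a * B + suc s * B   ≡⟨ collect (suc k * a) s B ⟩
  suc (suc k * a + s) * B     ≤⟨ *-monoˡ-≤ B (s≤s bound) ⟩
  suc n * B                   ≡⟨ [1+k]*[1+n]C[1+k]≡[1+n]*nCk n k ⟨
  suc k * (suc n C suc k)     ∎)
  where
  open ≤-Reasoning
  B : ℕ
  B = n C k
  k<n : k < n
  k<n = ≤-trans (≤-trans (m≤m*n (suc k) a) (m≤m+n _ s)) bound
  1+k≤B : suc k ≤ B
  1+k≤B = subst (_≤ B) ([1+n]Cn≡1+n k) (C-monoˡ-≤ k k<n)
  s[1+k]<[1+s]B : suc k * s < suc s * B
  s[1+k]<[1+s]B = begin-strict
    suc k * s      <⟨ *-monoʳ-< (suc k) (n<1+n s) ⟩
    suc k * suc s  ≡⟨ *-comm (suc k) (suc s) ⟩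
    suc s * suc k  ≤⟨ *-monoʳ-≤ (suc s) 1+k≤B ⟩
    suc s * B      ∎
  expand : ∀ c a B s → c * (a * B + s) ≡ c * a * B + c * s
  expand = solve-∀
  collect : ∀ c s B → c * B + suc s * B ≡ suc (c + s) * B
  collect = solve-∀

[m∸1]C[ℓ∸1]-dominates : ∀ {t s ℓ m E} → 2 ≤ ℓ → 2 + (ℓ * (suc ℓ + t * ℓ) + s) ≤ m →
  E ≤ (m ∸ 2) C (ℓ ∸ 2) → suc ℓ * ((m ∸ 2) C (ℓ ∸ 2)) + t * ℓ * E + s < (m ∸ 1) C (ℓ ∸ 1)
[m∸1]C[ℓ∸1]-dominates {t} {s} {ℓ@(suc (suc q))} {suc (suc p)} {E} (s≤s (s≤s _)) (s≤s (s≤s size)) E≤B =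
  begin-strict
    suc ℓ * B + t * ℓ * E + s  ≤⟨ +-monoˡ-≤ s (+-monoʳ-≤ (suc ℓ * B) (*-monoʳ-≤ (t * ℓ) E≤B)) ⟩
    suc ℓ * B + t * ℓ * B + s  ≡⟨ cong (_+ s) (*-distribʳ-+ B (suc ℓ) (t * ℓ)) ⟨
    (suc ℓ + t * ℓ) * B + s    <⟨ a*nCk+s<[1+n]C[1+k] {p} {q} (≤-trans (+-monoˡ-≤ s [1+q]a≤ℓa) size) ⟩
    suc p C suc q              ∎
  where
  open ≤-Reasoning
  B : ℕ
  B = p C q
  [1+q]a≤ℓa : suc q * (suc ℓ + t * ℓ) ≤ ℓ * (suc ℓ + t * ℓ)
  [1+q]a≤ℓa = *-monoˡ-≤ (suc ℓ + t * ℓ) (n≤1+n (suc q))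

t+1≤[t+2]C2 : ∀ t → t + 1 ≤ (t + 2) C 2
t+1≤[t+2]C2 t rewrite +-comm t 2 | +-comm t 1 =
  subst (_≤ suc (suc t) C 2) (nC1≡n (suc t)) (nCk≤[1+n]C[1+k] (suc t) 1)

size-bound : ∀ t ℓ s → 2 + (ℓ * (suc ℓ + t * ℓ) + s) + t ≤ 3 * ((t + 2) C 2) * (suc ℓ ^ 2 + s)
size-bound t ℓ s = begin
  2 + (ℓ * (suc ℓ + t * ℓ) + s) + t          ≤⟨ m≤m+n _ slack ⟩
  2 + (ℓ * (suc ℓ + t * ℓ) + s) + t + slack  ≡⟨ expand t ℓ s ⟩
  3 * (t + 1) * (suc ℓ ^ 2 + s)              ≤⟨ *-monoˡ-≤ (suc ℓ ^ 2 + s) (*-monoʳ-≤ 3 (t+1≤[t+2]C2 t)) ⟩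
  3 * ((t + 2) C 2) * (suc ℓ ^ 2 + s)        ∎
  where
  open ≤-Reasoning
  slack : ℕ
  slack = 2 * ℓ * ℓ + 5 * ℓ + 1 + t * (2 * ℓ * ℓ + 6 * ℓ + 2) + 2 * s + 3 * t * s
  -- stated with suc ℓ ^ 2 unfolded to (1 + ℓ) * ((1 + ℓ) * 1), the form the ring solver accepts
  expand : ∀ t a s → 2 + (a * (1 + a + t * a) + s) + t
                     + (2 * a * a + 5 * a + 1 + t * (2 * a * a + 6 * a + 2) + 2 * s + 3 * t * s)
                   ≡ 3 * (t + 1) * ((1 + a) * ((1 + a) * 1) + s)
  expand = solve-∀

m∸n≡1+m∸[n+1] : ∀ {m n} → n + 1 ≤ m → m ∸ n ≡ suc (m ∸ (n + 1))
m∸n≡1+m∸[n+1] {suc m} {zero}  (s≤s z≤n) = refl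
m∸n≡1+m∸[n+1] {suc m} {suc n} (s≤s le)  = m∸n≡1+m∸[n+1] le

[m+1]∸n≡1+[m∸n] : ∀ {m n} → n ≤ m → m + 1 ∸ n ≡ suc (m ∸ n)
[m+1]∸n≡1+[m∸n] {m} {n} n≤m = trans (+-∸-comm 1 n≤m) (+-comm (m ∸ n) 1)

g-step-identity : ∀ {n k t s x} → t ≤ x → x + 1 ≤ k → x + 1 ≤ n →
  g n k t s x + (n ∸ t ∸ 1) C (k ∸ t ∸ 1)
  ≡ g n k t s (x + 1)
    + ((k + 1 ∸ t) * ((n ∸ t ∸ 2) C (k ∸ t ∸ 2)) + t * (k ∸ t) * ((n ∸ (x + 1)) C (k ∸ x)) + s)
g-step-identity {n} {k} {t} {s} {x} t≤x x+1≤k x+1≤n =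
  regroup {E₀ = (n ∸ (x + 1)) C (k ∸ (x + 1))} {E₁ = (n ∸ (x + 1)) C (k ∸ x)} {d = t * (k ∸ t)}
          ([m+1]∸n≡1+[m∸n] t≤x)
          (m∸n≡1+m∸[n+1] (≤-trans x+1≤k (m≤m+n k 1)))
          (m∸n≡1+m∸[n+1] (≤-trans x+1≤k (m≤m+n k 3)))
          pascal
  where
  pascal : (n ∸ x) C (k ∸ x) ≡ (n ∸ (x + 1)) C (k ∸ (x + 1)) + (n ∸ (x + 1)) C (k ∸ x)
  pascal rewrite m∸n≡1+m∸[n+1] x+1≤n | m∸n≡1+m∸[n+1] x+1≤k =
    sym (nCk+nC[k+1]≡[n+1]C[k+1] (n ∸ (x + 1)) (k ∸ (x + 1)))
  identity : ∀ u w v E₀ E₁ G c B d s →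
    u * G + suc w * c * B + d * (E₀ + E₁) + s * suc v + G
    ≡ suc u * G + w * c * B + d * E₀ + s * v + (c * B + d * E₁ + s)
  identity = solve-∀
  regroup : ∀ {u u′ w w′ v v′ E E₀ E₁ G c B d} →
    u′ ≡ suc u → w ≡ suc w′ → v ≡ suc v′ → E ≡ E₀ + E₁ →
    u * G + w * c * B + d * E + s * v + G
    ≡ u′ * G + w′ * c * B + d * E₀ + s * v′ + (c * B + d * E₁ + s)
  regroup {u} {w′ = w} {v′ = v} {E₀ = E₀} {E₁} {G} {c} {B} {d} refl refl refl refl =
    identity u w v E₀ E₁ G c B d s

g-step-< : ∀ {n k t s x} → t ≤ x → x + 1 ≤ k → x + 1 ≤ n →
  suc (k ∸ t) * ((n ∸ t ∸ 2) C (k ∸ t ∸ 2)) + t * (k ∸ t) * ((n ∸ (x + 1)) C (k ∸ x)) + s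
    < (n ∸ t ∸ 1) C (k ∸ t ∸ 1) →
  g n k t s x < g n k t s (x + 1)
g-step-< {n} {k} {t} {s} {x} t≤x x+1≤k x+1≤n loss<gain = +-cancelʳ-< G _ _ (begin-strict
  g n k t s x + G                         ≡⟨ g-step-identity t≤x x+1≤k x+1≤n ⟩
  g n k t s (x + 1) + loss (k + 1 ∸ t)    ≡⟨ cong (λ c → g n k t s (x + 1) + loss c) ([m+1]∸n≡1+[m∸n] t≤k) ⟩
  g n k t s (x + 1) + loss (suc (k ∸ t))  <⟨ +-monoʳ-< (g n k t s (x + 1)) loss<gain ⟩
  g n k t s (x + 1) + G                   ∎)
  where
  open ≤-Reasoning
  t≤k : t ≤ k
  t≤k = ≤-trans t≤x (≤-trans (m≤m+n x 1) x+1≤k)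
  G : ℕ
  G = (n ∸ t ∸ 1) C (k ∸ t ∸ 1)
  loss : ℕ → ℕ
  loss c = c * ((n ∸ t ∸ 2) C (k ∸ t ∸ 2)) + t * (k ∸ t) * ((n ∸ (x + 1)) C (k ∸ x)) + s

lemma2p3 : (n k t s x : ℕ) → 1 ≤ n → 1 ≤ k → 1 ≤ t → 1 ≤ s →
    t + 3 ≤ k →
    3 * ((t + 2) C 2) * ((k + 1 ∸ t) ^ 2 + s) ≤ n →
    t + 2 ≤ x → x ≤ k ∸ 1 →
    g n k t s x < g n k t s (x + 1)
lemma2p3 n k t s x _ 1≤k _ _ _ large t+2≤x x≤k∸1 =
  g-step-< t≤x x+1≤k (≤-trans x+1≤k k≤n)
    ([m∸1]C[ℓ∸1]-dominates {t} 2≤ℓ (m+n≤o⇒m≤o∸n _ room) E≤B)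
  where
  x+1≤k : x + 1 ≤ k
  x+1≤k = m≤o∸n⇒m+n≤o x 1≤k x≤k∸1
  t+2≤k : t + 2 ≤ k
  t+2≤k = ≤-trans t+2≤x (≤-trans (m≤m+n x 1) x+1≤k)
  t≤x : t ≤ x
  t≤x = ≤-trans (m≤m+n t 2) t+2≤x
  t≤k : t ≤ k
  t≤k = ≤-trans (m≤m+n t 2) t+2≤k
  ℓ : ℕ
  ℓ = k ∸ t
  2≤ℓ : 2 ≤ ℓ
  2≤ℓ = m+n≤o⇒m≤o∸n 2 (subst (_≤ k) (+-comm t 2) t+2≤k)
  room : 2 + (ℓ * (suc ℓ + t * ℓ) + s) + t ≤ n
  room = ≤-trans (size-bound t ℓ s)
                 (subst (λ c → 3 * ((t + 2) C 2) * (c ^ 2 + s) ≤ n) ([m+1]∸n≡1+[m∸n] t≤k) large)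
  k≤n : k ≤ n
  k≤n = subst (_≤ n) (m∸n+n≡m t≤k) (≤-trans (+-monoˡ-≤ t ℓ≤room) room)
    where
    ℓ≤room : ℓ ≤ 2 + (ℓ * (suc ℓ + t * ℓ) + s)
    ℓ≤room = ≤-trans (m≤m*n ℓ (suc ℓ + t * ℓ)) (≤-trans (m≤m+n _ s) (m≤n+m _ 2))
  E≤B : (n ∸ (x + 1)) C (k ∸ x) ≤ (n ∸ t ∸ 2) C (ℓ ∸ 2)
  E≤B = subst₂ (λ a b → (n ∸ (x + 1)) C (k ∸ x) ≤ a C b)
               (sym (∸-+-assoc n t 2)) (sym (∸-+-assoc k t 2))
               ([n∸[x+1]]C[k∸x]≤[n∸i]C[k∸i] k≤n t+2≤x)
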